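{- Let $d, k, t \ge 0$ be integers with $t \le d$. Then $2f(k,d) \le f(k,d-t) + f(k,d+t)$.
   Context: For an integer $k \ge 0$, a $k$-independent set of a graph $G=(V,E)$ is a set $S \subseteq V$ such that the subgraph induced by $S$ has maximum degree at most $k$; $\alpha_k(G)$ is the maximum cardinality of a $k$-independent set of $G$. For a graph $G$, $n(G)$ is its number of vertices and $d(G) = \frac{1}{n(G)}\sum_{v}\deg(v)$ its average degree. For integers $d,k \ge 0$, $f(k,d) = \inf\left\{ \frac{\alpha_k(G)}{n(G)} : G \text{ is a finite simple graph with } d(G) \le d\right\}$. -}

module Defs where

open import Data.Bool using (Bool; true; false)
open import Data.Nat using (ℕ; zero; suc; _*_; _≤_; _≤?_; _⊔_; NonZero)
open import Data.Fin using (Fin)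
open import Data.Fin.Subset using (Subset; _∈_; _∩_; ∣_∣)
open import Data.Fin.Subset.Properties using (_∈?_)
open import Data.Fin.Properties using (all?)
open import Data.Vec using ([]; _∷_; tabulate)
open import Data.List using (List; []; _∷_; _++_; map; filter; foldr; allFin)
open import Data.Nat.ListAction using (sum)
open import Data.Integer using (+_)
open import Data.Rational using (ℚ; _/_)
open import Relation.Nullary.Decidable using (Dec; _→-dec_)
open import Relation.Binary.PropositionalEquality using (_≡_)

record Graph : Set where
  field
    n      : ℕ
    adj    : Fin n → Fin n → Bool
    sym    : ∀ u v → adj u v ≡ adj v u
    irrefl : ∀ v → adj v v ≡ false
open Graph public

N : (G : Graph) → Fin (n G) → Subset (n G)
N G v = tabulate (adj G v)

deg : (G : Graph) → Fin (n G) → ℕ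
deg G v = ∣ N G v ∣

degSum : Graph → ℕ
degSum G = sum (map (deg G) (allFin (n G)))

-- d(G) ≤ d, i.e. (1/n) Σ deg(v) ≤ d, written multiplied out by n
AvgDegAtMost : Graph → ℕ → Set
AvgDegAtMost G d = degSum G ≤ d * n G

KIndependent : (G : Graph) → ℕ → Subset (n G) → Set
KIndependent G k S = ∀ v → v ∈ S → ∣ N G v ∩ S ∣ ≤ k

kIndependent? : (G : Graph) (k : ℕ) (S : Subset (n G)) → Dec (KIndependent G k S)
kIndependent? G k S = all? (λ v → (v ∈? S) →-dec (∣ N G v ∩ S ∣ ≤? k))

subsets : (m : ℕ) → List (Subset m)
subsets zero = [] ∷ []
subsets (suc m) = map (true ∷_) (subsets m) ++ map (false ∷_) (subsets m)

alpha : ℕ → Graph → ℕ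
alpha k G = foldr _⊔_ 0 (map ∣_∣ (filter (kIndependent? G k) (subsets (n G))))

ratio : ℕ → (G : Graph) → .{{NonZero (n G)}} → ℚ
ratio k G = (+ alpha k G) / n G

-- Averaging construction: take n(H₂) disjoint copies of H₁ and
-- n(H₁) disjoint copies of H₂: both halves have n(H₁)n(H₂) vertices, so the average degree
-- of the union is the mean of d(H₁) ≤ d - t and d(H₂) ≤ d + t, hence at most d. A
-- k-independent set of a disjoint union splits into k-independent sets of the components,
-- so α_k of the union is at most n(H₂)α_k(H₁) + n(H₁)α_k(H₂), and dividing by the
-- 2n(H₁)n(H₂) vertices gives 2 α_k(G)/n(G) ≤ α_k(H₁)/n(H₁) + α_k(H₂)/n(H₂).
module Submission where

open import Defs

module DisjointUnions where
  open import Data.Bool using (Bool; true; false)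
  open import Data.Nat using (ℕ; zero; suc; _+_; _*_; _∸_; _≤_; _⊔_; z≤n; NonZero; >-nonZero; >-nonZero⁻¹)
  open import Data.Nat.Properties
    using (⊔-lub; m≤m⊔n; m≤n⊔m; ≤-trans; +-mono-≤; +-monoʳ-≤; +-identityʳ; *-monoʳ-≤; *-monoˡ-≤;
           *-comm; *-assoc; *-distribʳ-+; *-distribˡ-+; +-comm; +-assoc; m∸n+n≡m; m≤m+n; m*n≢0;
           module ≤-Reasoning)
  open import Data.Nat.ListAction using (sum)
  open import Data.Nat.ListAction.Properties using (sum-++)
  open import Data.Fin using (Fin; splitAt; _↑ˡ_; _↑ʳ_)
  open import Data.Fin.Properties using (splitAt-↑ˡ; splitAt-↑ʳ)
  open import Data.Fin.Subset using (Subset; ⊥; _∩_; ∣_∣; _∈_)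
  open import Data.Fin.Subset.Properties using (∣⊥∣≡0; ∩-zeroˡ)
  open import Data.Vec as Vec using ([]; _∷_; _++_; tabulate)
  open import Data.Vec.Properties as Vec using (zipWith-++; lookup-++ˡ; lookup-++ʳ; []=⇒lookup; lookup⇒[]=)
  open import Data.List as List using (List; foldr)
  import Data.List.Properties as List
  open import Data.List.Relation.Unary.All as All using (All; []; _∷_)
  open import Data.List.Relation.Unary.All.Properties using (all-filter; map⁺)
  open import Data.List.Relation.Unary.Any using (here; there)
  open import Data.List.Membership.Propositional using () renaming (_∈_ to _∈ₗ_)
  open import Data.List.Membership.Propositional.Properties using (∈-map⁺; ∈-filter⁺; ∈-++⁺ˡ; ∈-++⁺ʳ)
  open import Data.Product using (_,_)
  open import Data.Sum using (_⊎_; inj₁; inj₂)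
  open import Function using (_∘_)
  open import Relation.Binary.PropositionalEquality
    as ≡ using (_≡_; refl; trans; cong; cong₂; subst; module ≡-Reasoning)

  private
    variable
      a b m : ℕ
      A : Set

  foldr-⊔-lub : ∀ {x} (xs : List ℕ) → All (_≤ x) xs → foldr _⊔_ 0 xs ≤ x
  foldr-⊔-lub List.[]       []         = z≤n
  foldr-⊔-lub (_ List.∷ xs) (px ∷ pxs) = ⊔-lub px (foldr-⊔-lub xs pxs)

  ∈⇒≤foldr-⊔ : ∀ {x} {xs : List ℕ} → x ∈ₗ xs → x ≤ foldr _⊔_ 0 xs
  ∈⇒≤foldr-⊔ (here refl) = m≤m⊔n _ _
  ∈⇒≤foldr-⊔ (there p)   = ≤-trans (∈⇒≤foldr-⊔ p) (m≤n⊔m _ _)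

  ∈-subsets : (S : Subset m) → S ∈ₗ subsets m
  ∈-subsets []            = here refl
  ∈-subsets (true ∷ S)    = ∈-++⁺ˡ (∈-map⁺ (true ∷_) (∈-subsets S))
  ∈-subsets (false ∷ S)   = ∈-++⁺ʳ _ (∈-map⁺ (false ∷_) (∈-subsets S))

  ∣S∣≤alpha : ∀ {k} G {S} → KIndependent G k S → ∣ S ∣ ≤ alpha k G
  ∣S∣≤alpha {k} G {S} S-indep =
    ∈⇒≤foldr-⊔ (∈-map⁺ ∣_∣ (∈-filter⁺ (kIndependent? G k) (∈-subsets S) S-indep))

  alpha≤ : ∀ {k x} G → (∀ S → KIndependent G k S → ∣ S ∣ ≤ x) → alpha k G ≤ x
  alpha≤ {k} G bound = foldr-⊔-lub _
    (map⁺ (All.map (λ {S} → bound S) (all-filter (kIndependent? G k) (subsets (n G)))))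

  ∣p++q∣≡∣p∣+∣q∣ : (p : Subset a) (q : Subset b) → ∣ p ++ q ∣ ≡ ∣ p ∣ + ∣ q ∣
  ∣p++q∣≡∣p∣+∣q∣ []          q = refl
  ∣p++q∣≡∣p∣+∣q∣ (true ∷ p)  q = cong suc (∣p++q∣≡∣p∣+∣q∣ p q)
  ∣p++q∣≡∣p∣+∣q∣ (false ∷ p) q = ∣p++q∣≡∣p∣+∣q∣ p q

  ∣p++⊥∣≡∣p∣ : (p : Subset a) → ∣ p ++ ⊥ {n = b} ∣ ≡ ∣ p ∣
  ∣p++⊥∣≡∣p∣ {b = b} p = trans (∣p++q∣≡∣p∣+∣q∣ p ⊥) (trans (cong (∣ p ∣ +_) (∣⊥∣≡0 b)) (+-identityʳ _))

  ∣⊥++q∣≡∣q∣ : ∀ a (q : Subset b) → ∣ ⊥ {n = a} ++ q ∣ ≡ ∣ q ∣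
  ∣⊥++q∣≡∣q∣ a q = trans (∣p++q∣≡∣p∣+∣q∣ (⊥ {n = a}) q) (cong (_+ ∣ q ∣) (∣⊥∣≡0 a))

  ∩-++ : (p r : Subset a) (q s : Subset b) → (p ++ q) ∩ (r ++ s) ≡ (p ∩ r) ++ (q ∩ s)
  ∩-++ p r q s = zipWith-++ _ p q r s

  x∈p⇒x↑ˡ∈p++q : ∀ {x} {p : Subset a} (q : Subset b) → x ∈ p → x ↑ˡ b ∈ p ++ q
  x∈p⇒x↑ˡ∈p++q {x = x} {p} q x∈p =
    lookup⇒[]= _ (p ++ q) (trans (lookup-++ˡ p q x) ([]=⇒lookup x∈p))

  x∈q⇒a↑ʳx∈p++q : ∀ {x} (p : Subset a) {q : Subset b} → x ∈ q → a ↑ʳ x ∈ p ++ q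
  x∈q⇒a↑ʳx∈p++q {x = x} p {q} x∈q =
    lookup⇒[]= _ (p ++ q) (trans (lookup-++ʳ p q x) ([]=⇒lookup x∈q))

  tabulate-++ : ∀ a (f : Fin (a + b) → A) →
                tabulate f ≡ tabulate (f ∘ (_↑ˡ b)) ++ tabulate (f ∘ (a ↑ʳ_))
  tabulate-++ zero    f = refl
  tabulate-++ (suc a) f = cong (f Fin.zero ∷_) (tabulate-++ a (f ∘ Fin.suc))
    where import Data.Fin as Fin

  List-tabulate-++ : ∀ a (f : Fin (a + b) → A) →
    List.tabulate f ≡ List.tabulate (f ∘ (_↑ˡ b)) List.++ List.tabulate (f ∘ (a ↑ʳ_))
  List-tabulate-++ zero    f = refl
  List-tabulate-++ (suc a) f = cong (f Fin.zero List.∷_) (List-tabulate-++ a (f ∘ Fin.suc))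
    where import Data.Fin as Fin

  tabulate-false : tabulate (λ (_ : Fin a) → false) ≡ ⊥
  tabulate-false {a = zero}  = refl
  tabulate-false {a = suc a} = cong (false ∷_) tabulate-false

  adj-⊎ : (Fin a → Fin a → Bool) → (Fin b → Fin b → Bool) → Fin a ⊎ Fin b → Fin a ⊎ Fin b → Bool
  adj-⊎ adjA adjB (inj₁ u) (inj₁ v) = adjA u v
  adj-⊎ adjA adjB (inj₂ u) (inj₂ v) = adjB u v
  adj-⊎ adjA adjB _        _        = false

  infixr 5 _⊕_
  _⊕_ : Graph → Graph → Graph
  G ⊕ H = record
    { n      = n G + n H
    ; adj    = λ u v → adj-⊎ (adj G) (adj H) (splitAt (n G) u) (splitAt (n G) v)
    ; sym    = λ u v → adj-⊎-sym (splitAt (n G) u) (splitAt (n G) v)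
    ; irrefl = λ u → adj-⊎-irrefl (splitAt (n G) u)
    }
    where
    adj-⊎-sym : ∀ x y → adj-⊎ (adj G) (adj H) x y ≡ adj-⊎ (adj G) (adj H) y x
    adj-⊎-sym (inj₁ u) (inj₁ v) = sym G u v
    adj-⊎-sym (inj₂ u) (inj₂ v) = sym H u v
    adj-⊎-sym (inj₁ u) (inj₂ v) = refl
    adj-⊎-sym (inj₂ u) (inj₁ v) = refl
    adj-⊎-irrefl : ∀ x → adj-⊎ (adj G) (adj H) x x ≡ false
    adj-⊎-irrefl (inj₁ u) = irrefl G u
    adj-⊎-irrefl (inj₂ u) = irrefl H u

  module _ (G H : Graph) where

    N-⊕-↑ˡ : ∀ u → N (G ⊕ H) (u ↑ˡ n H) ≡ N G u ++ ⊥
    N-⊕-↑ˡ u = trans (tabulate-++ (n G) _) (cong₂ _++_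
      (Vec.tabulate-cong λ v →
        cong₂ (adj-⊎ (adj G) (adj H)) (splitAt-↑ˡ (n G) u (n H)) (splitAt-↑ˡ (n G) v (n H)))
      (trans (Vec.tabulate-cong λ v →
        cong₂ (adj-⊎ (adj G) (adj H)) (splitAt-↑ˡ (n G) u (n H)) (splitAt-↑ʳ (n G) (n H) v))
        tabulate-false))

    N-⊕-↑ʳ : ∀ u → N (G ⊕ H) (n G ↑ʳ u) ≡ ⊥ ++ N H u
    N-⊕-↑ʳ u = trans (tabulate-++ (n G) _) (cong₂ _++_
      (trans (Vec.tabulate-cong λ v →
        cong₂ (adj-⊎ (adj G) (adj H)) (splitAt-↑ʳ (n G) (n H) u) (splitAt-↑ˡ (n G) v (n H)))
        tabulate-false)
      (Vec.tabulate-cong λ v →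
        cong₂ (adj-⊎ (adj G) (adj H)) (splitAt-↑ʳ (n G) (n H) u) (splitAt-↑ʳ (n G) (n H) v)))

    deg-⊕-↑ˡ : ∀ u → deg (G ⊕ H) (u ↑ˡ n H) ≡ deg G u
    deg-⊕-↑ˡ u = trans (cong ∣_∣ (N-⊕-↑ˡ u)) (∣p++⊥∣≡∣p∣ (N G u))

    deg-⊕-↑ʳ : ∀ u → deg (G ⊕ H) (n G ↑ʳ u) ≡ deg H u
    deg-⊕-↑ʳ u = trans (cong ∣_∣ (N-⊕-↑ʳ u)) (∣⊥++q∣≡∣q∣ (n G) (N H u))

    degSum-⊕ : degSum (G ⊕ H) ≡ degSum G + degSum H
    degSum-⊕ = begin
      degSum (G ⊕ H)
        ≡⟨ cong sum (List.map-tabulate (λ u → u) (deg (G ⊕ H))) ⟩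
      sum (List.tabulate (deg (G ⊕ H)))
        ≡⟨ cong sum (List-tabulate-++ (n G) (deg (G ⊕ H))) ⟩
      sum (List.tabulate (deg (G ⊕ H) ∘ (_↑ˡ n H)) List.++ List.tabulate (deg (G ⊕ H) ∘ (n G ↑ʳ_)))
        ≡⟨ sum-++ (List.tabulate (deg (G ⊕ H) ∘ (_↑ˡ n H))) _ ⟩
      sum (List.tabulate (deg (G ⊕ H) ∘ (_↑ˡ n H))) + sum (List.tabulate (deg (G ⊕ H) ∘ (n G ↑ʳ_)))
        ≡⟨ cong₂ _+_ (cong sum (List.tabulate-cong deg-⊕-↑ˡ)) (cong sum (List.tabulate-cong deg-⊕-↑ʳ)) ⟩
      sum (List.tabulate (deg G)) + sum (List.tabulate (deg H))
        ≡⟨ cong₂ _+_ (cong sum (List.map-tabulate (λ u → u) (deg G)))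
                     (cong sum (List.map-tabulate (λ u → u) (deg H))) ⟨
      degSum G + degSum H ∎
      where open ≡-Reasoning

    KIndependent-⊕⁻ˡ : ∀ {k} p q → KIndependent (G ⊕ H) k (p ++ q) → KIndependent G k p
    KIndependent-⊕⁻ˡ {k} p q indep u u∈p =
      subst (_≤ k) N∩S≡ (indep (u ↑ˡ n H) (x∈p⇒x↑ˡ∈p++q q u∈p))
      where
      open ≡-Reasoning
      N∩S≡ : ∣ N (G ⊕ H) (u ↑ˡ n H) ∩ (p ++ q) ∣ ≡ ∣ N G u ∩ p ∣
      N∩S≡ = begin
        ∣ N (G ⊕ H) (u ↑ˡ n H) ∩ (p ++ q) ∣ ≡⟨ cong (λ X → ∣ X ∩ (p ++ q) ∣) (N-⊕-↑ˡ u) ⟩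
        ∣ (N G u ++ ⊥) ∩ (p ++ q) ∣         ≡⟨ cong ∣_∣ (∩-++ (N G u) p ⊥ q) ⟩
        ∣ (N G u ∩ p) ++ (⊥ ∩ q) ∣           ≡⟨ cong (λ X → ∣ (N G u ∩ p) ++ X ∣) (∩-zeroˡ q) ⟩
        ∣ (N G u ∩ p) ++ ⊥ ∣                 ≡⟨ ∣p++⊥∣≡∣p∣ (N G u ∩ p) ⟩
        ∣ N G u ∩ p ∣                        ∎

    KIndependent-⊕⁻ʳ : ∀ {k} p q → KIndependent (G ⊕ H) k (p ++ q) → KIndependent H k q
    KIndependent-⊕⁻ʳ {k} p q indep u u∈q =
      subst (_≤ k) N∩S≡ (indep (n G ↑ʳ u) (x∈q⇒a↑ʳx∈p++q p u∈q))
      where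
      open ≡-Reasoning
      N∩S≡ : ∣ N (G ⊕ H) (n G ↑ʳ u) ∩ (p ++ q) ∣ ≡ ∣ N H u ∩ q ∣
      N∩S≡ = begin
        ∣ N (G ⊕ H) (n G ↑ʳ u) ∩ (p ++ q) ∣ ≡⟨ cong (λ X → ∣ X ∩ (p ++ q) ∣) (N-⊕-↑ʳ u) ⟩
        ∣ (⊥ ++ N H u) ∩ (p ++ q) ∣         ≡⟨ cong ∣_∣ (∩-++ ⊥ p (N H u) q) ⟩
        ∣ (⊥ ∩ p) ++ (N H u ∩ q) ∣           ≡⟨ cong (λ X → ∣ X ++ (N H u ∩ q) ∣) (∩-zeroˡ {n = n G} p) ⟩
        ∣ ⊥ {n = n G} ++ (N H u ∩ q) ∣       ≡⟨ ∣⊥++q∣≡∣q∣ (n G) (N H u ∩ q) ⟩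
        ∣ N H u ∩ q ∣                        ∎

    alpha-⊕ : ∀ k → alpha k (G ⊕ H) ≤ alpha k G + alpha k H
    alpha-⊕ k = alpha≤ (G ⊕ H) bound
      where
      bound : ∀ S → KIndependent (G ⊕ H) k S → ∣ S ∣ ≤ alpha k G + alpha k H
      bound S indep with Vec.splitAt (n G) S
      ... | p , q , refl = subst (_≤ alpha k G + alpha k H) (≡.sym (∣p++q∣≡∣p∣+∣q∣ p q))
        (+-mono-≤ (∣S∣≤alpha G (KIndependent-⊕⁻ˡ p q indep))
                  (∣S∣≤alpha H (KIndependent-⊕⁻ʳ p q indep)))

  emptyGraph : Graph
  emptyGraph = record { n = 0 ; adj = λ () ; sym = λ () ; irrefl = λ () }

  copies : ℕ → Graph → Graph
  copies zero    H = emptyGraph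
  copies (suc m) H = H ⊕ copies m H

  n-copies : ∀ m H → n (copies m H) ≡ m * n H
  n-copies zero    H = refl
  n-copies (suc m) H = cong (n H +_) (n-copies m H)

  degSum-copies : ∀ m H → degSum (copies m H) ≡ m * degSum H
  degSum-copies zero    H = refl
  degSum-copies (suc m) H = trans (degSum-⊕ H (copies m H)) (cong (degSum H +_) (degSum-copies m H))

  alpha-copies : ∀ k m H → alpha k (copies m H) ≤ m * alpha k H
  alpha-copies k zero    H = z≤n
  alpha-copies k (suc m) H =
    ≤-trans (alpha-⊕ H (copies m H) k) (+-monoʳ-≤ (alpha k H) (alpha-copies k m H))

  AvgDegAtMost-copies : ∀ m H d → AvgDegAtMost H d → AvgDegAtMost (copies m H) d
  AvgDegAtMost-copies m H d H≤d = begin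
    degSum (copies m H) ≡⟨ degSum-copies m H ⟩
    m * degSum H        ≤⟨ *-monoʳ-≤ m H≤d ⟩
    m * (d * n H)       ≡⟨ *-comm m (d * n H) ⟩
    d * n H * m         ≡⟨ *-assoc d (n H) m ⟩
    d * (n H * m)       ≡⟨ cong (d *_) (trans (*-comm (n H) m) (≡.sym (n-copies m H))) ⟩
    d * n (copies m H)  ∎
    where open ≤-Reasoning

  AvgDegAtMost-⊕ : ∀ G H a b d → n G ≡ n H → a + b ≤ d + d →
                   AvgDegAtMost G a → AvgDegAtMost H b → AvgDegAtMost (G ⊕ H) d
  AvgDegAtMost-⊕ G H a b d nG≡nH a+b≤d+d G≤a H≤b = begin
    degSum (G ⊕ H)          ≡⟨ degSum-⊕ G H ⟩
    degSum G + degSum H     ≤⟨ +-mono-≤ G≤a H≤b ⟩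
    a * n G + b * n H       ≡⟨ cong (λ x → a * n G + b * x) (≡.sym nG≡nH) ⟩
    a * n G + b * n G       ≡⟨ *-distribʳ-+ (n G) a b ⟨
    (a + b) * n G           ≤⟨ *-monoˡ-≤ (n G) a+b≤d+d ⟩
    (d + d) * n G           ≡⟨ *-distribʳ-+ (n G) d d ⟩
    d * n G + d * n G       ≡⟨ *-distribˡ-+ d (n G) (n G) ⟨
    d * (n G + n G)         ≡⟨ cong (λ x → d * (n G + x)) nG≡nH ⟩
    d * (n G + n H)         ∎
    where open ≤-Reasoning

  [m∸n]+[m+n]≡m+m : ∀ {m n} → n ≤ m → (m ∸ n) + (m + n) ≡ m + m
  [m∸n]+[m+n]≡m+m {m} {n} n≤m = begin
    (m ∸ n) + (m + n) ≡⟨ cong ((m ∸ n) +_) (+-comm m n) ⟩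
    (m ∸ n) + (n + m) ≡⟨ +-assoc (m ∸ n) n m ⟨
    (m ∸ n) + n + m   ≡⟨ cong (_+ m) (m∸n+n≡m n≤m) ⟩
    m + m             ∎
    where open ≡-Reasoning

  blowUp : Graph → Graph → Graph
  blowUp H₁ H₂ = copies (n H₂) H₁ ⊕ copies (n H₁) H₂

  module _ (H₁ H₂ : Graph) where

    n-blowUp : n (blowUp H₁ H₂) ≡ n H₂ * n H₁ + n H₁ * n H₂
    n-blowUp = cong₂ _+_ (n-copies (n H₂) H₁) (n-copies (n H₁) H₂)

    nonZero-blowUp : .{{_ : NonZero (n H₁)}} .{{_ : NonZero (n H₂)}} → NonZero (n (blowUp H₁ H₂))
    nonZero-blowUp = subst NonZero (≡.sym n-blowUp)
      (>-nonZero (≤-trans (>-nonZero⁻¹ (n H₂ * n H₁)) (m≤m+n _ _)))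
      where instance _ = m*n≢0 (n H₂) (n H₁)

    AvgDegAtMost-blowUp : ∀ a b d → a + b ≤ d + d →
      AvgDegAtMost H₁ a → AvgDegAtMost H₂ b → AvgDegAtMost (blowUp H₁ H₂) d
    AvgDegAtMost-blowUp a b d a+b≤d+d H₁≤a H₂≤b =
      AvgDegAtMost-⊕ (copies (n H₂) H₁) (copies (n H₁) H₂) a b d
      (trans (n-copies (n H₂) H₁) (trans (*-comm (n H₂) (n H₁)) (≡.sym (n-copies (n H₁) H₂))))
      a+b≤d+d (AvgDegAtMost-copies (n H₂) H₁ a H₁≤a) (AvgDegAtMost-copies (n H₁) H₂ b H₂≤b)

    alpha-blowUp : ∀ k → alpha k (blowUp H₁ H₂) ≤ n H₂ * alpha k H₁ + n H₁ * alpha k H₂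
    alpha-blowUp k = ≤-trans (alpha-⊕ (copies (n H₂) H₁) (copies (n H₁) H₂) k)
      (+-mono-≤ (alpha-copies k (n H₂) H₁) (alpha-copies k (n H₁) H₂))

module Fractions where
  open import Data.Nat as ℕ using (suc; NonZero)
  open import Data.Nat.Properties as ℕ using (module ≤-Reasoning)
  open import Data.Nat.Tactic.RingSolver using (solve-∀)
  open import Data.Integer as ℤ using (+_; +≤+)
  open import Data.Integer.Properties using (pos-*; pos-+)
  open import Data.Rational using (_/_; toℚᵘ; _+_; _*_; _≤_; 0ℚ; 1ℚ)
  open import Data.Rational.Properties
    using (toℚᵘ-fromℚᵘ; toℚᵘ-homo-+; toℚᵘ-homo-*; toℚᵘ-cancel-≤; ≤-trans; ≤-reflexive; +-identityʳ; +-monoʳ-≤)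
  open import Data.Rational.Unnormalised as ℚᵘ using (mkℚᵘ; _≃_; *≤*)
  open import Data.Rational.Unnormalised.Properties as ℚᵘ
    using (≃-refl; ≃-sym; ≃-trans; +-cong; *-cong; ≤-respˡ-≃; ≤-respʳ-≃)
  open import Relation.Binary.PropositionalEquality as ≡ using (_≡_; refl; trans; cong; cong₂; subst₂)

  toℚᵘ-/ : ∀ i n .{{_ : NonZero n}} → toℚᵘ (i / n) ≃ (i ℚᵘ./ n)
  toℚᵘ-/ i (suc n) = toℚᵘ-fromℚᵘ (mkℚᵘ i n)

  private
    twice-mean : ∀ a n₁ n₂ → 2 ℕ.* a ℕ.* (n₁ ℕ.* n₂) ≡ a ℕ.* (n₂ ℕ.* n₁ ℕ.+ n₁ ℕ.* n₂)
    twice-mean = solve-∀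

    cross-sum : ∀ a₁ a₂ n₁ n₂ N → (n₂ ℕ.* a₁ ℕ.+ n₁ ℕ.* a₂) ℕ.* N ≡ (a₁ ℕ.* n₂ ℕ.+ a₂ ℕ.* n₁) ℕ.* (1 ℕ.* N)
    cross-sum = solve-∀

  -- Unnormalised fractions keep the numerators and denominators given here, so `*≤*` reduces
  -- the claim to cross-multiplied naturals.
  2*[a/N]≤a₁/n₁+a₂/n₂ᵘ : ∀ a a₁ a₂ N n₁ n₂ .{{_ : NonZero N}} .{{_ : NonZero n₁}} .{{_ : NonZero n₂}} →
    N ≡ n₂ ℕ.* n₁ ℕ.+ n₁ ℕ.* n₂ → a ℕ.≤ n₂ ℕ.* a₁ ℕ.+ n₁ ℕ.* a₂ →
    mkℚᵘ (+ 2) 0 ℚᵘ.* (+ a ℚᵘ./ N) ℚᵘ.≤ (+ a₁ ℚᵘ./ n₁) ℚᵘ.+ (+ a₂ ℚᵘ./ n₂)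
  2*[a/N]≤a₁/n₁+a₂/n₂ᵘ a a₁ a₂ N@(suc _) n₁@(suc _) n₂@(suc _) refl a≤ =
    *≤* (subst₂ ℤ._≤_ lhs rhs (+≤+ cross-multiplied))
    where
    cross-multiplied : 2 ℕ.* a ℕ.* (n₁ ℕ.* n₂) ℕ.≤ (a₁ ℕ.* n₂ ℕ.+ a₂ ℕ.* n₁) ℕ.* (1 ℕ.* N)
    cross-multiplied = begin
      2 ℕ.* a ℕ.* (n₁ ℕ.* n₂)                     ≡⟨ twice-mean a n₁ n₂ ⟩
      a ℕ.* N                                     ≤⟨ ℕ.*-monoˡ-≤ N a≤ ⟩
      (n₂ ℕ.* a₁ ℕ.+ n₁ ℕ.* a₂) ℕ.* N             ≡⟨ cross-sum a₁ a₂ n₁ n₂ N ⟩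
      (a₁ ℕ.* n₂ ℕ.+ a₂ ℕ.* n₁) ℕ.* (1 ℕ.* N)     ∎
      where open ≤-Reasoning
    lhs : + (2 ℕ.* a ℕ.* (n₁ ℕ.* n₂)) ≡ (+ 2 ℤ.* + a) ℤ.* + (n₁ ℕ.* n₂)
    lhs = trans (pos-* (2 ℕ.* a) (n₁ ℕ.* n₂)) (cong (ℤ._* + (n₁ ℕ.* n₂)) (pos-* 2 a))
    rhs : + ((a₁ ℕ.* n₂ ℕ.+ a₂ ℕ.* n₁) ℕ.* (1 ℕ.* N)) ≡ (+ a₁ ℤ.* + n₂ ℤ.+ + a₂ ℤ.* + n₁) ℤ.* + (1 ℕ.* N)
    rhs = trans (pos-* (a₁ ℕ.* n₂ ℕ.+ a₂ ℕ.* n₁) (1 ℕ.* N))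
      (cong (ℤ._* + (1 ℕ.* N))
        (trans (pos-+ (a₁ ℕ.* n₂) (a₂ ℕ.* n₁)) (cong₂ ℤ._+_ (pos-* a₁ n₂) (pos-* a₂ n₁))))

  p≤p+q : ∀ {p q} → 0ℚ ≤ q → p ≤ p + q
  p≤p+q {p} 0≤q = ≤-trans (≤-reflexive (≡.sym (+-identityʳ p))) (+-monoʳ-≤ p 0≤q)

  2*[a/N]≤a₁/n₁+a₂/n₂ : ∀ a a₁ a₂ N n₁ n₂ .{{_ : NonZero N}} .{{_ : NonZero n₁}} .{{_ : NonZero n₂}} →
    N ≡ n₂ ℕ.* n₁ ℕ.+ n₁ ℕ.* n₂ → a ℕ.≤ n₂ ℕ.* a₁ ℕ.+ n₁ ℕ.* a₂ →
    (1ℚ + 1ℚ) * (+ a / N) ≤ + a₁ / n₁ + + a₂ / n₂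
  2*[a/N]≤a₁/n₁+a₂/n₂ a a₁ a₂ N n₁ n₂ N≡ a≤ = toℚᵘ-cancel-≤
    (≤-respˡ-≃ (≃-sym lhs) (≤-respʳ-≃ (≃-sym rhs) (2*[a/N]≤a₁/n₁+a₂/n₂ᵘ a a₁ a₂ N n₁ n₂ N≡ a≤)))
    where
    lhs : toℚᵘ ((1ℚ + 1ℚ) * (+ a / N)) ≃ mkℚᵘ (+ 2) 0 ℚᵘ.* (+ a ℚᵘ./ N)
    lhs = ≃-trans (toℚᵘ-homo-* (1ℚ + 1ℚ) (+ a / N)) (*-cong (≃-refl {mkℚᵘ (+ 2) 0}) (toℚᵘ-/ (+ a) N))
    rhs : toℚᵘ (+ a₁ / n₁ + + a₂ / n₂) ≃ (+ a₁ ℚᵘ./ n₁) ℚᵘ.+ (+ a₂ ℚᵘ./ n₂)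
    rhs = ≃-trans (toℚᵘ-homo-+ (+ a₁ / n₁) (+ a₂ / n₂)) (+-cong (toℚᵘ-/ (+ a₁) n₁) (toℚᵘ-/ (+ a₂) n₂))

open DisjointUnions
  using (blowUp; n-blowUp; nonZero-blowUp; AvgDegAtMost-blowUp; alpha-blowUp; [m∸n]+[m+n]≡m+m)
open Fractions using (2*[a/N]≤a₁/n₁+a₂/n₂; p≤p+q)

open import Data.Nat using (ℕ; _∸_; NonZero)
open import Data.Product using (Σ-syntax; _×_; _,_)
open import Data.Rational using (ℚ; _+_; _*_; _≤_; _<_; 0ℚ; 1ℚ)
open import Data.Rational.Properties using (≤-trans; <⇒≤)
open import Data.Nat.Properties using (≤-reflexive)

theorem13 : (d k t : ℕ) → t Data.Nat.≤ d →
    (H₁ H₂ : Graph) → .{{_ : NonZero (n H₁)}} → .{{_ : NonZero (n H₂)}} →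
    AvgDegAtMost H₁ (d ∸ t) → AvgDegAtMost H₂ (d Data.Nat.+ t) →
    (ε : ℚ) → 0ℚ < ε →
    Σ[ G ∈ Graph ] Σ[ nz ∈ NonZero (n G) ]
      (AvgDegAtMost G d ×
       (1ℚ + 1ℚ) * ratio k G {{nz}} ≤ ratio k H₁ + ratio k H₂ + ε)
theorem13 d k t t≤d H₁ H₂ H₁≤d∸t H₂≤d+t ε 0<ε =
  blowUp H₁ H₂ , nonZero-blowUp H₁ H₂ , avgDeg , ≤-trans averaged (p≤p+q (<⇒≤ 0<ε))
  where
  instance _ = nonZero-blowUp H₁ H₂
  avgDeg : AvgDegAtMost (blowUp H₁ H₂) d
  avgDeg = AvgDegAtMost-blowUp H₁ H₂ (d ∸ t) (d Data.Nat.+ t) d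
    (≤-reflexive ([m∸n]+[m+n]≡m+m t≤d)) H₁≤d∸t H₂≤d+t
  averaged : (1ℚ + 1ℚ) * ratio k (blowUp H₁ H₂) ≤ ratio k H₁ + ratio k H₂
  averaged = 2*[a/N]≤a₁/n₁+a₂/n₂ (alpha k (blowUp H₁ H₂)) (alpha k H₁) (alpha k H₂)
    (n (blowUp H₁ H₂)) (n H₁) (n H₂) (n-blowUp H₁ H₂) (alpha-blowUp H₁ H₂ k)
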